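{- Let $\Sigma_{\mathrm{dec}}=(\Sigma_{\mathrm{eq}},\Sigma_0)$ be a decorated specification and let $\Sigma_A=F_{\mathrm{param}}(\Sigma_{\mathrm{dec}})$. Let $\mathbb{A}$ be a set and $M_A\colon\Sigma_A\to\mathrm{Set}_{\mathbb{A}}$ a set-valued model in $L_A$, and let $M_0$ be the restriction of $M_A$ to $\Sigma_0$. Then there is a function $$\mathcal{M}\colon\mathbb{A}\to L_{\mathrm{eq}}[\Sigma_{\mathrm{eq}},\mathrm{Set}]|_{M_0}$$ mapping each $\alpha\in\mathbb{A}$ to a model $\mathcal{M}(\alpha)$ of $\Sigma_{\mathrm{eq}}$ which extends $M_0$ and satisfies $\mathcal{M}(\alpha)(f)=M_A(f')(\alpha,-)$ for every term $f\colon X\to Y$ of $\Sigma_{\mathrm{eq}}$.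
   Context: An equational specification is a finite product sketch: a graph (types and terms) with potential identities, composites, binary and terminal products, binary tuples and collapsing terms; a set-valued model is a graph morphism into Set sending these to actual identities, composites, cartesian products, tuples, singleton and unique maps. A decorated specification $(\Sigma_{\mathrm{eq}},\Sigma_0)$ consists of an equational specification $\Sigma_{\mathrm{eq}}$ and a wide subspecification $\Sigma_0$ (same types), whose terms are called pure; identities, projections, collapsing terms are pure, composites and tuples of pure terms are pure. $\Sigma_A=F_{\mathrm{param}}(\Sigma_{\mathrm{dec}})$ is the equational specification with distinguished type $A$ obtained by keeping types and pure features and replacing every general term $f\colon X\to Y$ of $\Sigma_{\mathrm{eq}}$ by $f'\colon A\times X\to Y$, with general composites $g\circ f$ becoming $g'\circ\langle\pi_X,f'\rangle$ and general pairings $\langle f,g\rangle$ becoming $\langle f',g'\rangle$ (where $\pi_X,\varepsilon_X$ are the projections of $A\times X$); for pure $f$, one has $f'=f\circ\varepsilon_X$. Thus $\Sigma_0$ is a subspecification of $\Sigma_A$ and every $f\colon X\to Y$ in $\Sigma_{\mathrm{eq}}$ has a corresponding $f'\colon A\times X\to Y$ in $\Sigma_A$. $\mathrm{Set}_{\mathbb{A}}$ denotes the equational theory of sets (cartesian products as chosen products) with $A$ interpreted as $\mathbb{A}$; a model $M_A\colon\Sigma_A\to\mathrm{Set}_{\mathbb{A}}$ is thus a set-valued model of $\Sigma_A$ with $M_A(A)=\mathbb{A}$. $L_{\mathrm{eq}}[\Sigma_{\mathrm{eq}},\mathrm{Set}]|_{M_0}$ denotes the set of set-valued models of $\Sigma_{\mathrm{eq}}$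 whose restriction to $\Sigma_0$ is $M_0$. -}

module Defs where

open import Data.Product using (Σ; _×_; _,_; proj₁; proj₂)
open import Relation.Binary.PropositionalEquality using (_≡_)
open import Function.Definitions using (Bijective)

-- Equational specifications (finite product sketches), presented as a
-- graph (types, terms) together with the designated potential features.

record Spec : Set₁ where
  field
    Ty    : Set
    Tm    : Ty → Ty → Set
    Ident : ∀ {X} → Tm X X → Set
    -- h is a potential composite  g ∘ f
    Comp  : ∀ {X Y Z} → Tm X Y → Tm Y Z → Tm X Z → Set
    Prod  : ∀ {P X Y} → Tm P X → Tm P Y → Set
    -- h is the potential tuple  ⟨ f , g ⟩  w.r.t. the product cone c
    Tuple : ∀ {Z P X Y} {p₁ : Tm P X} {p₂ : Tm P Y} →
            Prod p₁ p₂ → Tm Z X → Tm Z Y → Tm Z P → Set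
    Term  : Ty → Set
    Collapse : ∀ {Z U} → Term U → Tm Z U → Set

open Spec public

record Interp (S : Spec) : Set₁ where
  field
    obj : Ty S → Set
    hom : ∀ {X Y} → Tm S X Y → obj X → obj Y

open Interp public

record IsModel (S : Spec) (M : Interp S) : Set where
  field
    ident : ∀ {X} {f : Tm S X X} → Ident S f →
            ∀ x → hom M f x ≡ x
    comp  : ∀ {X Y Z} {f : Tm S X Y} {g : Tm S Y Z} {h : Tm S X Z} →
            Comp S f g h → ∀ x → hom M h x ≡ hom M g (hom M f x)
    prod  : ∀ {P X Y} {p₁ : Tm S P X} {p₂ : Tm S P Y} → Prod S p₁ p₂ →
            Bijective _≡_ _≡_ (λ z → hom M p₁ z , hom M p₂ z)
    tuple : ∀ {Z P X Y} {p₁ : Tm S P X} {p₂ : Tm S P Y}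
              {f : Tm S Z X} {g : Tm S Z Y} {h : Tm S Z P} →
            (c : Prod S p₁ p₂) → Tuple S c f g h →
            ∀ z → (hom M p₁ (hom M h z) ≡ hom M f z) × (hom M p₂ (hom M h z) ≡ hom M g z)
    terminal : ∀ {U} → Term S U → Σ (obj M U) (λ u → ∀ v → v ≡ u)
    collapse : ∀ {Z U} {t : Term S U} {f : Tm S Z U} → Collapse S t f →
               ∀ z → hom M f z ≡ proj₁ (terminal t)

-- Decorated specifications: Σ_eq with a wide subspecification Σ_0 of
-- pure terms (same types; features of Σ_0 = features of Σ_eq among pure
-- terms), closed as required.

record DecSpec : Set₁ where
  field
    eq   : Spec
    Pure : ∀ {X Y} → Tm eq X Y → Set
    ident-pure : ∀ {X} {f : Tm eq X X} → Ident eq f → Pure f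
    proj₁-pure : ∀ {P X Y} {p₁ : Tm eq P X} {p₂ : Tm eq P Y} → Prod eq p₁ p₂ → Pure p₁
    proj₂-pure : ∀ {P X Y} {p₁ : Tm eq P X} {p₂ : Tm eq P Y} → Prod eq p₁ p₂ → Pure p₂
    collapse-pure : ∀ {Z U} {t : Term eq U} {f : Tm eq Z U} → Collapse eq t f → Pure f
    comp-pure : ∀ {X Y Z} {f : Tm eq X Y} {g : Tm eq Y Z} {h : Tm eq X Z} →
                Comp eq f g h → Pure f → Pure g → Pure h
    tuple-pure : ∀ {Z P X Y} {p₁ : Tm eq P X} {p₂ : Tm eq P Y}
                   {f : Tm eq Z X} {g : Tm eq Z Y} {h : Tm eq Z P}
                   {c : Prod eq p₁ p₂} → Tuple eq c f g h → Pure f → Pure g → Pure h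

open DecSpec public

module _ (D : DecSpec) where
  private
    E = eq D

  Σ₀ : Spec
  Σ₀ = record
    { Ty = Ty E
    ; Tm = λ X Y → Σ (Tm E X Y) (Pure D)
    ; Ident = λ f → Ident E (proj₁ f)
    ; Comp = λ f g h → Comp E (proj₁ f) (proj₁ g) (proj₁ h)
    ; Prod = λ p₁ p₂ → Prod E (proj₁ p₁) (proj₁ p₂)
    ; Tuple = λ c f g h → Tuple E c (proj₁ f) (proj₁ g) (proj₁ h)
    ; Term = Term E
    ; Collapse = λ t f → Collapse E t (proj₁ f)
    }

  data TyA : Set where
    ⌜_⌝ : Ty E → TyA
    𝐀   : TyA
    𝐀×_ : Ty E → TyA

  data TmA : TyA → TyA → Set where
    pure : ∀ {X Y} (f : Tm E X Y) → Pure D f → TmA ⌜ X ⌝ ⌜ Y ⌝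
    _′   : ∀ {X Y} (f : Tm E X Y) → TmA (𝐀× X) ⌜ Y ⌝
    π    : ∀ X → TmA (𝐀× X) 𝐀
    ε    : ∀ X → TmA (𝐀× X) ⌜ X ⌝
    pair : ∀ {X Y} (f : Tm E X Y) → TmA (𝐀× X) (𝐀× Y)     -- ⟨ π_X , f′ ⟩

  data IdentA : ∀ {X} → TmA X X → Set where
    ident₀ : ∀ {X} {f : Tm E X X} (i : Ident E f) (p : Pure D f) → IdentA (pure f p)

  data CompA : ∀ {X Y Z} → TmA X Y → TmA Y Z → TmA X Z → Set where
    comp₀ : ∀ {X Y Z} {f : Tm E X Y} {g : Tm E Y Z} {h : Tm E X Z} →
            Comp E f g h → (pf : Pure D f) (pg : Pure D g) (ph : Pure D h) →
            CompA (pure f pf) (pure g pg) (pure h ph)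
    compA-pure : ∀ {X Y} {f : Tm E X Y} (p : Pure D f) → CompA (ε X) (pure f p) (f ′)
    compA-gen : ∀ {X Y Z} {f : Tm E X Y} {g : Tm E Y Z} {h : Tm E X Z} →
               Comp E f g h → CompA (pair f) (g ′) (h ′)

  data ProdA : ∀ {P X Y} → TmA P X → TmA P Y → Set where
    prod₀ : ∀ {P X Y} {p₁ : Tm E P X} {p₂ : Tm E P Y} (c : Prod E p₁ p₂) →
            (q₁ : Pure D p₁) (q₂ : Pure D p₂) → ProdA (pure p₁ q₁) (pure p₂ q₂)
    prod-A : ∀ X → ProdA (π X) (ε X)

  data TupleA : ∀ {Z P X Y} {p₁ : TmA P X} {p₂ : TmA P Y} →
                ProdA p₁ p₂ → TmA Z X → TmA Z Y → TmA Z P → Set where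
    tuple₀ : ∀ {Z P X Y} {p₁ : Tm E P X} {p₂ : Tm E P Y}
               {f : Tm E Z X} {g : Tm E Z Y} {h : Tm E Z P}
               (c : Prod E p₁ p₂) (q₁ : Pure D p₁) (q₂ : Pure D p₂) →
             Tuple E c f g h → (pf : Pure D f) (pg : Pure D g) (ph : Pure D h) →
             TupleA (prod₀ c q₁ q₂) (pure f pf) (pure g pg) (pure h ph)
    tuple-gen : ∀ {Z P X Y} {p₁ : Tm E P X} {p₂ : Tm E P Y}
                  {f : Tm E Z X} {g : Tm E Z Y} {h : Tm E Z P}
                  (c : Prod E p₁ p₂) (q₁ : Pure D p₁) (q₂ : Pure D p₂) →
                Tuple E c f g h → TupleA (prod₀ c q₁ q₂) (f ′) (g ′) (h ′)
    tuple-pair : ∀ {X Y} (f : Tm E X Y) → TupleA (prod-A Y) (π X) (f ′) (pair f)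

  data TermA : TyA → Set where
    term₀ : ∀ {U} → Term E U → TermA ⌜ U ⌝

  data CollapseA : ∀ {Z U} → TermA U → TmA Z U → Set where
    collapse₀ : ∀ {Z U} {t : Term E U} {f : Tm E Z U} →
                Collapse E t f → (p : Pure D f) → CollapseA (term₀ t) (pure f p)

  ΣA : Spec
  ΣA = record
    { Ty = TyA ; Tm = TmA ; Ident = IdentA ; Comp = CompA ; Prod = ProdA
    ; Tuple = TupleA ; Term = TermA ; Collapse = CollapseA }

  restrict : Interp ΣA → Interp Σ₀
  restrict M = record
    { obj = λ X → obj M ⌜ X ⌝
    ; hom = λ f → hom M (pure (proj₁ f) (proj₂ f)) }

  -- L_eq[Σ_eq, Set]|_{M₀} : set-valued models of Σ_eq whose restriction
  -- to Σ_0 is M₀ (same types, same interpretation of pure terms).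
  -- The object map is that of M₀ by construction.
  record ModelOver (M₀ : Interp Σ₀) : Set₁ where
    field
      homM     : ∀ {X Y} → Tm E X Y → obj M₀ X → obj M₀ Y
    model : Interp E
    model = record { obj = obj M₀ ; hom = homM }
    field
      isModel  : IsModel E model
      extends  : ∀ {X Y} (f : Tm E X Y) (p : Pure D f) →
                 ∀ x → homM f x ≡ hom M₀ (f , p) x

open ModelOver public

module Submission where

-- Since A × X is sent to a cartesian product, every pair
-- (α , x) ∈ 𝔸 × M_A(X) is represented by a unique point ⟨α , x⟩ of
-- M_A(A × X).  Define ℳ(α)(f)(x) = M_A(f′)⟨α , x⟩, i.e. "evaluate the
-- parametrised term f′ at the parameter α".  Then
--   * pure terms: f′ = f ∘ ε_X, so ℳ(α)(f) = M₀(f);  hence identities,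
--     product cones, terminal types and collapsing terms of Σ_eq, which
--     are all pure, are respected because M_A respects them;
--   * composites: (g ∘ f)′ = g′ ∘ ⟨π_X , f′⟩ and ⟨π_X , f′⟩ maps ⟨α , x⟩
--     to ⟨α , ℳ(α)(f)(x)⟩, so ℳ(α)(g ∘ f) = ℳ(α)(g) ∘ ℳ(α)(f);
--   * tuples: ⟨f , g⟩′ = ⟨f′ , g′⟩.

open import Defs
open import Data.Product using (Σ; _×_; _,_; proj₁; proj₂)
open import Function.Definitions using (Bijective)
open import Relation.Binary.PropositionalEquality
  using (_≡_; _≗_; refl; sym; trans; cong; cong₂; subst)
open import Relation.Binary.PropositionalEquality.Properties using (subst-sym-subst)

-- Bijectivity is invariant under replacing a map by a pointwise equal one;
-- needed because ℳ(α) agrees with M₀ on projections only pointwise.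
bijective-resp-≗ : ∀ {A B : Set} {f g : A → B} → f ≗ g →
                   Bijective _≡_ _≡_ f → Bijective _≡_ _≡_ g
bijective-resp-≗ {f = f} {g} f≗g (inj , surj) =
    (λ {x} {y} gx≡gy → inj (trans (f≗g x) (trans gx≡gy (sym (f≗g y)))))
  , λ b → proj₁ (surj b) , λ {a} a≡x → trans (sym (f≗g a)) (proj₂ (surj b) a≡x)

subst-back : ∀ {S T : Set} (e : S ≡ T) (s : S) (t : T) →
             subst (λ U → U) e s ≡ t → s ≡ subst (λ U → U) (sym e) t
subst-back e s t refl = sym (subst-sym-subst e)

module ProductCone {S : Spec} {M : Interp S} (isM : IsModel S M)
                   {P X Y : Ty S} {p₁ : Tm S P X} {p₂ : Tm S P Y}
                   (c : Prod S p₁ p₂) where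
  open IsModel isM using (prod)

  ⟨_,_⟩ : obj M X → obj M Y → obj M P
  ⟨ x , y ⟩ = proj₁ (proj₂ (prod c) (x , y))

  ⟨,⟩-projections : ∀ x y → (hom M p₁ ⟨ x , y ⟩ , hom M p₂ ⟨ x , y ⟩) ≡ (x , y)
  ⟨,⟩-projections x y = proj₂ (proj₂ (prod c) (x , y)) refl

  ⟨,⟩-proj₁ : ∀ x y → hom M p₁ ⟨ x , y ⟩ ≡ x
  ⟨,⟩-proj₁ x y = cong proj₁ (⟨,⟩-projections x y)

  ⟨,⟩-proj₂ : ∀ x y → hom M p₂ ⟨ x , y ⟩ ≡ y
  ⟨,⟩-proj₂ x y = cong proj₂ (⟨,⟩-projections x y)

  ⟨,⟩-unique : ∀ x y z → hom M p₁ z ≡ x → hom M p₂ z ≡ y → ⟨ x , y ⟩ ≡ z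
  ⟨,⟩-unique x y z p₁z≡x p₂z≡y =
    proj₁ (prod c) (trans (⟨,⟩-projections x y) (sym (cong₂ _,_ p₁z≡x p₂z≡y)))

module Evaluation (D : DecSpec) (𝔸 : Set) (MA : Interp (ΣA D))
                  (isMA : IsModel (ΣA D) MA) (eqA : obj MA 𝐀 ≡ 𝔸) where
  open IsModel isMA
  private
    E = eq D
    M₀ = restrict D MA

  param : 𝔸 → obj MA 𝐀
  param = subst (λ U → U) (sym eqA)

  module _ {X : Ty E} where
    open ProductCone isMA (prod-A X) public

  evalAt : 𝔸 → ∀ {X Y} → Tm E X Y → obj MA ⌜ X ⌝ → obj MA ⌜ Y ⌝
  evalAt α f x = hom MA (f ′) ⟨ param α , x ⟩

  interpAt : 𝔸 → Interp E
  interpAt α = record { obj = obj M₀ ; hom = evalAt α }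

  -- On pure terms ℳ(α) is M₀, because f′ = f ∘ ε_X.
  evalAt-pure : ∀ α {X Y} (f : Tm E X Y) (p : Pure D f) x →
                evalAt α f x ≡ hom MA (pure f p) x
  evalAt-pure α f p x =
    trans (comp (compA-pure p) ⟨ param α , x ⟩)
          (cong (hom MA (pure f p)) (⟨,⟩-proj₂ (param α) x))

  pair-at : ∀ α {X Y} (f : Tm E X Y) x →
            ⟨ param α , evalAt α f x ⟩ ≡ hom MA (pair f) ⟨ param α , x ⟩
  pair-at α {X} {Y} f x = ⟨,⟩-unique (param α) (evalAt α f x) _
    (trans (proj₁ tuple-eqs) (⟨,⟩-proj₁ (param α) x))
    (proj₂ tuple-eqs)
    where tuple-eqs = tuple (prod-A Y) (tuple-pair f) ⟨ param α , x ⟩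

  -- ℳ(α) sends composites to composites, as (g ∘ f)′ = g′ ∘ ⟨π_X , f′⟩.
  evalAt-comp : ∀ α {X Y Z} {f : Tm E X Y} {g : Tm E Y Z} {h : Tm E X Z} →
                Comp E f g h → ∀ x → evalAt α h x ≡ evalAt α g (evalAt α f x)
  evalAt-comp α {f = f} {g} c x =
    trans (comp (compA-gen c) ⟨ param α , x ⟩)
          (cong (hom MA (g ′)) (sym (pair-at α f x)))

  -- Product cones of Σ_eq consist of pure terms, so M₀ already makes them
  -- cartesian products.
  evalAt-prod : ∀ α {P X Y} {p₁ : Tm E P X} {p₂ : Tm E P Y} → Prod E p₁ p₂ →
                Bijective _≡_ _≡_ (λ z → evalAt α p₁ z , evalAt α p₂ z)
  evalAt-prod α {p₁ = p₁} {p₂} c =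
    bijective-resp-≗ (λ z → sym (cong₂ _,_ (evalAt-pure α p₁ q₁ z) (evalAt-pure α p₂ q₂ z)))
                     (prod (prod₀ c q₁ q₂))
    where q₁ = proj₁-pure D c
          q₂ = proj₂-pure D c

  -- Tuples are respected, as ⟨f , g⟩′ = ⟨f′ , g′⟩ and projections are pure.
  evalAt-tuple : ∀ α {Z P X Y} {p₁ : Tm E P X} {p₂ : Tm E P Y}
                   {f : Tm E Z X} {g : Tm E Z Y} {h : Tm E Z P} →
                 (c : Prod E p₁ p₂) → Tuple E c f g h → ∀ z →
                 (evalAt α p₁ (evalAt α h z) ≡ evalAt α f z) ×
                 (evalAt α p₂ (evalAt α h z) ≡ evalAt α g z)
  evalAt-tuple α {p₁ = p₁} {p₂} c t z =
      trans (evalAt-pure α p₁ q₁ _) (proj₁ tuple-eqs)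
    , trans (evalAt-pure α p₂ q₂ _) (proj₂ tuple-eqs)
    where q₁ = proj₁-pure D c
          q₂ = proj₂-pure D c
          tuple-eqs = tuple (prod₀ c q₁ q₂) (tuple-gen c q₁ q₂ t) ⟨ param α , z ⟩

  isModelAt : ∀ α → IsModel E (interpAt α)
  isModelAt α = record
    { ident    = λ {_} {f} i x →
        trans (evalAt-pure α f (ident-pure D i) x) (ident (ident₀ i (ident-pure D i)) x)
    ; comp     = evalAt-comp α
    ; prod     = evalAt-prod α
    ; tuple    = evalAt-tuple α
    ; terminal = λ t → terminal (term₀ t)
    ; collapse = λ {_} {_} {_} {f} c z →
        trans (evalAt-pure α f (collapse-pure D c) z)
              (collapse (collapse₀ c (collapse-pure D c)) z)
    }

  ℳ : 𝔸 → ModelOver D M₀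
  ℳ α = record { homM = evalAt α ; isModel = isModelAt α ; extends = evalAt-pure α }

proposition3p3 : (D : DecSpec) (𝔸 : Set) (MA : Interp (ΣA D)) → IsModel (ΣA D) MA →
    (eqA : obj MA 𝐀 ≡ 𝔸) →
    Σ (𝔸 → ModelOver D (restrict D MA)) (λ ℳ →
      ∀ (α : 𝔸) {X Y} (f : Tm (eq D) X Y) (x : obj MA ⌜ X ⌝) (w : obj MA (𝐀× X)) →
        subst (λ S → S) eqA (hom MA (π X) w) ≡ α → hom MA (ε X) w ≡ x →
        homM (ℳ α) f x ≡ hom MA (f ′) w)
proposition3p3 D 𝔸 MA isMA eqA = ℳ , evaluates-f′
  where
  open Evaluation D 𝔸 MA isMA eqA
  -- w has projections α and x, so it is ⟨α , x⟩ and ℳ(α)(f)(x) = M_A(f′)(w).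
  evaluates-f′ : ∀ (α : 𝔸) {X Y} (f : Tm (eq D) X Y) (x : obj MA ⌜ X ⌝) (w : obj MA (𝐀× X)) →
                 subst (λ S → S) eqA (hom MA (π X) w) ≡ α → hom MA (ε X) w ≡ x →
                 evalAt α f x ≡ hom MA (f ′) w
  evaluates-f′ α f x w πw≡α εw≡x =
    cong (hom MA (f ′)) (⟨,⟩-unique (param α) x w (subst-back eqA _ α πw≡α) εw≡x)
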